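{- Let $0<\nu<1$ and let $H$ be a graph on $n$ vertices with $\theta(H)\le 5$. If $H$ is $\nu$-triangular extreme, then $|V_\Delta|\ge n(1-7\nu)$.
   Context: The Ore-degree $\theta(H)$ is the maximum of $\deg_H(x)+\deg_H(y)$ over edges $xy\in E(H)$. $H$ is $\nu$-triangular extreme if it contains at least $(1-\nu)n/3$ pairwise vertex-disjoint triangles. $V_\Delta$ denotes the set of vertices of $H$ that belong to a triangle of $H$ all three of whose vertices have degree exactly $2$ in $H$.
   Formalization: The parameter ν takes only rational values. -}

module Defs where

open import Data.Nat using (ℕ; _+_; _≤_)
open import Data.Fin using (Fin)
open import Data.Bool using (Bool; true; false; T; if_then_else_; _∧_)
open import Data.List using (List; map; allFin)
open import Data.Nat.ListAction using (sum)
open import Data.Bool.ListAction using (any)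
open import Data.Product using (Σ; _×_; _,_)
open import Data.Sum using (_⊎_)
open import Data.Empty using (⊥)
open import Data.Integer using (+_)
open import Relation.Nullary using (¬_)
open import Relation.Binary.PropositionalEquality using (_≡_; _≢_)
import Data.Rational as ℚ
open ℚ using (ℚ; 1ℚ; 0ℚ)
open import Data.Nat using (_≡ᵇ_)

record Graph (n : ℕ) : Set where
  field
    adj   : Fin n → Fin n → Bool
    sym   : ∀ x y → adj x y ≡ adj y x
    irref : ∀ x → adj x x ≡ false

open Graph public

module _ {n : ℕ} (H : Graph n) where

  Edge : Fin n → Fin n → Set
  Edge x y = T (adj H x y)

  deg : Fin n → ℕ
  deg x = sum (map (λ y → if adj H x y then 1 else 0) (allFin n))

  OreDegreeAtMost : ℕ → Set
  OreDegreeAtMost k = ∀ x y → Edge x y → deg x + deg y ≤ k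

  Triangle : Set
  Triangle = Σ (Fin n × Fin n × Fin n) λ { (a , b , c) → Edge a b × Edge b c × Edge a c }

  _∈▵_ : Fin n → Triangle → Set
  u ∈▵ ((a , b , c) , _) = u ≡ a ⊎ u ≡ b ⊎ u ≡ c

  HasDisjointTriangles : ℕ → Set
  HasDisjointTriangles t =
    Σ (Fin t → Triangle) λ tri →
      ∀ i j → i ≢ j → ∀ u → u ∈▵ tri i → ¬ (u ∈▵ tri j)

  TriangularExtreme : ℚ → Set
  TriangularExtreme ν =
    Σ ℕ λ t → HasDisjointTriangles t ×
      ((1ℚ ℚ.- ν) ℚ.* (+ n ℚ./ 1) ℚ.≤ (+ 3 ℚ./ 1) ℚ.* (+ t ℚ./ 1))

  inVΔ : Fin n → Bool
  inVΔ x = any (λ y → any (λ z →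
               adj H x y ∧ adj H y z ∧ adj H x z ∧
               (deg x ≡ᵇ 2) ∧ (deg y ≡ᵇ 2) ∧ (deg z ≡ᵇ 2))
             (allFin n)) (allFin n)

  sizeVΔ : ℕ
  sizeVΔ = sum (map (λ x → if inVΔ x then 1 else 0) (allFin n))

module Submission where

-- Call a triangle of the family good if its three corners have degree 2 (then
-- they all lie in V_Δ) and bad otherwise.  A bad triangle has a corner x with
-- deg x ≥ 3; then x has a neighbour w, its exit, that lies in no triangle of the
-- family, and θ(H) ≤ 5 forces deg w ≤ 2.  Give every vertex six tokens.  Each
-- triangle claims the 18 tokens of its corners and three more: its own corners as
-- elements of V_Δ if it is good, or three tokens of its exit if it is bad, chosen
-- according to the position (first or second) of x among the at most two
-- neighbours of w.  Distinct claims get distinct tokens, so 21t ≤ 6n + |V_Δ|, and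
-- the bound on |V_Δ| follows from 3t ≥ (1-ν)n by linear arithmetic over ℚ.

open import Defs hiding (sym)
open import Data.Nat using (ℕ)
open import Data.Fin using (Fin)
open import Relation.Nullary using (¬_)
open import Relation.Binary.PropositionalEquality using (_≢_)

module Counting where

  open import Data.Nat using (suc; _≤_)
  open import Data.Fin using (Fin; zero; suc)
  open import Data.Fin.Properties using (injective⇒≤)
  open import Data.Bool using (Bool; true; false; if_then_else_)
  open import Data.List using (List; []; _∷_; map; filter; length; lookup)
  open import Data.Nat.ListAction using (sum)
  open import Data.List.Membership.Propositional using (_∈_)
  open import Data.List.Membership.Propositional.Properties using (∈-lookup)
  open import Data.List.Relation.Unary.Any using (index)
  open import Data.List.Relation.Unary.Any.Properties using (lookup-index)
  import Data.List.Relation.Unary.All as All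
  open import Data.List.Relation.Unary.AllPairs using (_∷_)
  open import Data.List.Relation.Unary.Unique.Propositional using (Unique)
  open import Data.Empty using (⊥-elim)
  open import Function using (_↣_; Injection; mk↣)
  open import Relation.Nullary.Decidable using (T?)
  open import Relation.Binary.PropositionalEquality

  -- Counting principle: an injection from Fin m whose values all occur in ys
  -- shows that ys has at least m entries (positions in ys are then distinct).
  injection⇒≤length : ∀ {m} {A : Set} {ys : List A} (f : Fin m ↣ A) →
                      (∀ i → Injection.to f i ∈ ys) → m ≤ length ys
  injection⇒≤length {ys = ys} f mem = injective⇒≤ position-injective
    where
    open Injection f using (to; injective)
    position-injective : ∀ {i j} → index (mem i) ≡ index (mem j) → i ≡ j
    position-injective {i} {j} eq = injective (begin
      to i                        ≡⟨ lookup-index (mem i) ⟩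
      lookup ys (index (mem i))   ≡⟨ cong (lookup ys) eq ⟩
      lookup ys (index (mem j))   ≡⟨ lookup-index (mem j) ⟨
      to j                        ∎)
      where open ≡-Reasoning

  lookup-injective : ∀ {A : Set} {xs : List A} → Unique xs →
                     ∀ {i j} → lookup xs i ≡ lookup xs j → i ≡ j
  lookup-injective (_ ∷ _)           {zero}  {zero}  _  = refl
  lookup-injective (x∉xs ∷ _)        {zero}  {suc j} eq = ⊥-elim (All.lookup x∉xs (∈-lookup j) eq)
  lookup-injective (x∉xs ∷ _)        {suc i} {zero}  eq = ⊥-elim (All.lookup x∉xs (∈-lookup i) (sym eq))
  lookup-injective (_ ∷ xs-unique)   {suc i} {suc j} eq = cong suc (lookup-injective xs-unique eq)

  unique⊆⇒length≤ : ∀ {A : Set} {xs ys : List A} → Unique xs →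
                    (∀ {x} → x ∈ xs → x ∈ ys) → length xs ≤ length ys
  unique⊆⇒length≤ {xs = xs} xs-unique xs⊆ys =
    injection⇒≤length (mk↣ (lookup-injective xs-unique)) (λ i → xs⊆ys (∈-lookup {xs = xs} i))

  indicatorSum≡length : ∀ {A : Set} (p : A → Bool) (xs : List A) →
    sum (map (λ y → if p y then 1 else 0) xs) ≡ length (filter (λ y → T? (p y)) xs)
  indicatorSum≡length p [] = refl
  indicatorSum≡length p (x ∷ xs) with p x
  ... | true  = cong suc (indicatorSum≡length p xs)
  ... | false = indicatorSum≡length p xs

module Degrees {n : ℕ} (H : Graph n) where

  open Counting
  open import Data.Nat using (_≤_)
  import Data.Nat.Properties as ℕP
  open import Data.Fin using (Fin; inject≤)
  open import Data.Fin.Properties using (inject≤-injective)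
  open import Data.Bool using (T)
  open import Data.List using (List; allFin; filter; length; lookup)
  open import Data.List.Membership.Propositional using (_∈_)
  open import Data.List.Membership.Propositional.Properties using (∈-allFin; ∈-filter⁺; ∈-filter⁻)
  open import Data.List.Relation.Unary.All as All using (All)
  open import Data.List.Relation.Unary.Any using (index)
  open import Data.List.Relation.Unary.Any.Properties using (lookup-index)
  open import Data.List.Relation.Unary.Unique.Propositional using (Unique)
  open import Data.List.Relation.Unary.Unique.Propositional.Properties using (allFin⁺; filter⁺)
  open import Data.Product using (proj₂)
  open import Relation.Nullary.Decidable using (T?)
  open import Relation.Binary.PropositionalEquality

  Edge-sym : ∀ {x y} → Edge H x y → Edge H y x
  Edge-sym {x} {y} = subst T (Graph.sym H x y)

  Edge-irrefl : ∀ {x} → ¬ Edge H x x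
  Edge-irrefl {x} = subst T (irref H x)

  neighbours : Fin n → List (Fin n)
  neighbours x = filter (λ y → T? (adj H x y)) (allFin n)

  deg≡length : ∀ x → deg H x ≡ length (neighbours x)
  deg≡length x = indicatorSum≡length (adj H x) (allFin n)

  ∈-neighbours : ∀ {x y} → Edge H x y → y ∈ neighbours x
  ∈-neighbours {x} {y} = ∈-filter⁺ (λ y → T? (adj H x y)) (∈-allFin y)

  length≤deg : ∀ {x} {xs : List (Fin n)} → Unique xs → All (Edge H x) xs → length xs ≤ deg H x
  length≤deg {x} xs-unique edges = subst (_ ≤_) (sym (deg≡length x))
    (unique⊆⇒length≤ xs-unique (λ y∈xs → ∈-neighbours (All.lookup edges y∈xs)))

  deg≤length : ∀ {x} {ys : List (Fin n)} → (∀ {y} → Edge H x y → y ∈ ys) → deg H x ≤ length ys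
  deg≤length {x} covers = subst (_≤ _) (sym (deg≡length x))
    (unique⊆⇒length≤ (filter⁺ (λ y → T? (adj H x y)) (allFin⁺ n))
      (λ y∈N → covers (proj₂ (∈-filter⁻ (λ y → T? (adj H x y)) {xs = allFin n} y∈N))))

  ore-neighbour≤2 : OreDegreeAtMost H 5 → ∀ {x w} → Edge H x w → 3 ≤ deg H x → deg H w ≤ 2
  ore-neighbour≤2 ore {x} {w} e x-big =
    ℕP.+-cancelˡ-≤ 3 (deg H w) 2 (ℕP.≤-trans (ℕP.+-monoˡ-≤ (deg H w) x-big) (ore x w e))

  label : ∀ {w x k} → deg H w ≤ k → Edge H w x → Fin k
  label {w} w-small e = inject≤ (index (∈-neighbours e)) (subst (_≤ _) (deg≡length w) w-small)

  label-injective : ∀ {w w' x x' k} (d : deg H w ≤ k) (d' : deg H w' ≤ k)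
                    (e : Edge H w x) (e' : Edge H w' x') →
                    w ≡ w' → label d e ≡ label d' e' → x ≡ x'
  label-injective {w} {x = x} {x'} d d' e e' refl eq = begin
    x                                               ≡⟨ lookup-index (∈-neighbours e) ⟩
    lookup (neighbours w) (index (∈-neighbours e))  ≡⟨ cong (lookup (neighbours w)) same-index ⟩
    lookup (neighbours w) (index (∈-neighbours e')) ≡⟨ lookup-index (∈-neighbours e') ⟨
    x'                                              ∎
    where
    open ≡-Reasoning
    same-index : index (∈-neighbours e) ≡ index (∈-neighbours e')
    same-index = inject≤-injective _ _ _ _ eq

module TriangleFamily {n : ℕ} (H : Graph n) (ore : OreDegreeAtMost H 5)
       {t : ℕ} (tri : Fin t → Triangle H)
       (disjoint : ∀ i j → i ≢ j → ∀ u → _∈▵_ H u (tri i) → ¬ (_∈▵_ H u (tri j))) where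

  open Counting
  open Degrees H
  open import Data.Nat as ℕ using (_≤_)
  import Data.Nat.Properties as ℕP
  open import Data.Fin using (Fin; zero; suc; punchIn; punchOut; combine)
  open import Data.Fin.Properties
    using (_≟_; any?; all?; ¬∀⟶∃¬; punchIn-injective; punchInᵢ≢i; punchIn-punchOut;
           combine-injective; combine-injectiveˡ; *↔×; +↔⊎)
  open import Data.Bool using (T; _∧_)
  open import Data.Bool.Properties using (T-∧)
  open import Data.List using (List; []; _∷_; allFin; filter; length; map; _++_)
  open import Data.List.Properties using (length-++; length-map; length-tabulate)
  open import Data.List.Membership.Propositional using (_∈_; lose)
  open import Data.List.Membership.Propositional.Properties
    using (∈-allFin; ∈-filter⁺; ∈-++⁺ˡ; ∈-++⁺ʳ; ∈-map⁺)
  open import Data.List.Relation.Unary.All using (All; []; _∷_)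
  open import Data.List.Relation.Unary.AllPairs using ([]; _∷_)
  open import Data.List.Relation.Unary.Any using (here; there)
  open import Data.List.Relation.Unary.Any.Properties using (any⁺)
  open import Data.List.Relation.Unary.Unique.Propositional using (Unique)
  open import Data.Product using (∃; _×_; _,_; proj₁; proj₂)
  open import Data.Product.Function.NonDependent.Propositional using (_×-↔_)
  open import Data.Sum using (_⊎_; inj₁; inj₂)
  open import Data.Sum.Properties using (inj₁-injective; inj₂-injective)
  open import Data.Sum.Function.Propositional using (_⊎-↔_)
  open import Data.Empty using (⊥-elim)
  open import Function using (_↔_; Equivalence; mk↣)
  open import Function.Construct.Composition using (injection)
  open import Function.Properties.Inverse using (↔-refl; ↔-trans; ↔⇒↣)
  open import Relation.Nullary using (yes; no)
  open import Relation.Nullary.Decidable using (T?; ¬?; _×-dec_; decidable-stable)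
  open import Relation.Binary.PropositionalEquality

  corner : Fin t → Fin 3 → Fin n
  corner i zero             = proj₁ (proj₁ (tri i))
  corner i (suc zero)       = proj₁ (proj₂ (proj₁ (tri i)))
  corner i (suc (suc zero)) = proj₂ (proj₂ (proj₁ (tri i)))

  corner-edge : ∀ i j k → j ≢ k → Edge H (corner i j) (corner i k)
  corner-edge i zero             zero             j≢k = ⊥-elim (j≢k refl)
  corner-edge i zero             (suc zero)       _   = proj₁ (proj₂ (tri i))
  corner-edge i zero             (suc (suc zero)) _   = proj₂ (proj₂ (proj₂ (tri i)))
  corner-edge i (suc zero)       zero             _   = Edge-sym (proj₁ (proj₂ (tri i)))
  corner-edge i (suc zero)       (suc zero)       j≢k = ⊥-elim (j≢k refl)
  corner-edge i (suc zero)       (suc (suc zero)) _   = proj₁ (proj₂ (proj₂ (tri i)))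
  corner-edge i (suc (suc zero)) zero             _   = Edge-sym (proj₂ (proj₂ (proj₂ (tri i))))
  corner-edge i (suc (suc zero)) (suc zero)       _   = Edge-sym (proj₁ (proj₂ (proj₂ (tri i))))
  corner-edge i (suc (suc zero)) (suc (suc zero)) j≢k = ⊥-elim (j≢k refl)

  corner-∈▵ : ∀ i j → _∈▵_ H (corner i j) (tri i)
  corner-∈▵ i zero             = inj₁ refl
  corner-∈▵ i (suc zero)       = inj₂ (inj₁ refl)
  corner-∈▵ i (suc (suc zero)) = inj₂ (inj₂ refl)

  -- Disjointness and irreflexivity: a vertex is a corner in at most one way.
  corner-injective : ∀ i j i' j' → corner i j ≡ corner i' j' → i ≡ i' × j ≡ j'
  corner-injective i j i' j' eq with i ≟ i'
  ... | no i≢i' = ⊥-elim (disjoint i i' i≢i' _ (corner-∈▵ i j)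
                                    (subst (λ u → _∈▵_ H u (tri i')) (sym eq) (corner-∈▵ i' j')))
  ... | yes refl with j ≟ j'
  ...   | yes j≡j' = refl , j≡j'
  ...   | no j≢j'  = ⊥-elim (Edge-irrefl (subst (Edge H (corner i j)) (sym eq) (corner-edge i j j' j≢j')))

  other≢ : ∀ (j : Fin 3) a → j ≢ punchIn j a
  other≢ j a eq = punchInᵢ≢i j a (sym eq)

  others-distinct : ∀ (j : Fin 3) → punchIn j zero ≢ punchIn j (suc zero)
  others-distinct j eq with punchIn-injective j zero (suc zero) eq
  ... | ()

  otherCorners : Fin t → Fin 3 → List (Fin n)
  otherCorners i j = corner i (punchIn j zero) ∷ corner i (punchIn j (suc zero)) ∷ []

  otherCorners-unique : ∀ i j → Unique (otherCorners i j)
  otherCorners-unique i j =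
    ((λ eq → others-distinct j (proj₂ (corner-injective i _ i _ eq))) ∷ []) ∷ [] ∷ []

  otherCorners-edges : ∀ i j → All (Edge H (corner i j)) (otherCorners i j)
  otherCorners-edges i j = corner-edge i j _ (other≢ j zero) ∷ corner-edge i j _ (other≢ j (suc zero)) ∷ []

  own-neighbour : ∀ i j {k} → Edge H (corner i j) (corner i k) → corner i k ∈ otherCorners i j
  own-neighbour i j {k} e with j ≟ k
  ... | yes refl = ⊥-elim (Edge-irrefl e)
  ... | no j≢k with punchOut j≢k | punchIn-punchOut j≢k
  ...   | zero       | eq = here (cong (corner i) (sym eq))
  ...   | suc zero   | eq = there (here (cong (corner i) (sym eq)))

  corner-deg≥2 : ∀ i j → 2 ≤ deg H (corner i j)
  corner-deg≥2 i j = length≤deg (otherCorners-unique i j) (otherCorners-edges i j)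

  AllDeg2 : Fin t → Set
  AllDeg2 i = ∀ j → deg H (corner i j) ≡ 2

  allDeg2⇒inVΔ : ∀ {i} → AllDeg2 i → ∀ j → T (inVΔ H (corner i j))
  allDeg2⇒inVΔ {i} deg2 j =
    any⁺ _ (lose (∈-allFin y) (any⁺ _ (lose (∈-allFin z)
      (corner-edge i j _ (other≢ j zero) ∧ᵀ corner-edge i _ _ (others-distinct j) ∧ᵀ corner-edge i j _ (other≢ j (suc zero)) ∧ᵀ
       is2 j ∧ᵀ is2 (punchIn j zero) ∧ᵀ is2 (punchIn j (suc zero))))))
    where
    y z : Fin n
    y = corner i (punchIn j zero)
    z = corner i (punchIn j (suc zero))
    infixr 4 _∧ᵀ_
    _∧ᵀ_ : ∀ {a b} → T a → T b → T (a ∧ b)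
    p ∧ᵀ q = Equivalence.from T-∧ (p , q)
    is2 : ∀ k → T (deg H (corner i k) ℕ.≡ᵇ 2)
    is2 k = ℕP.≡⇒≡ᵇ _ 2 (deg2 k)

  record Exit (i : Fin t) : Set where
    field
      exitCorner   : Fin 3
      exit         : Fin n
      toExit       : Edge H (corner i exitCorner) exit
      exit-deg≤2   : deg H exit ≤ 2
      exit-outside : ∀ i' k → corner i' k ≢ exit
  open Exit

  Foreign : Fin t → Fin n → Set
  Foreign i w = ¬ (∃ λ k → w ≡ corner i k)

  -- A corner of degree at least 3 has a foreign neighbour: its neighbours within its
  -- own triangle are only the two other corners.
  foreignNeighbour : ∀ i j → 3 ≤ deg H (corner i j) → ∃ λ w → Edge H (corner i j) w × Foreign i w
  foreignNeighbour i j x-big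
    with any? (λ w → T? (adj H (corner i j) w) ×-dec ¬? (any? (λ k → w ≟ corner i k)))
  ... | yes found = found
  ... | no none = ⊥-elim (ℕP.<⇒≱ x-big (deg≤length only-own))
    where
    only-own : ∀ {y} → Edge H (corner i j) y → y ∈ otherCorners i j
    only-own {y} e with decidable-stable (any? (λ k → y ≟ corner i k)) (λ foreign → none (y , e , foreign))
    ... | k , refl = own-neighbour i j {k} e

  -- A foreign neighbour w of a corner x of triangle i with deg w ≤ 2 is a corner of
  -- no triangle at all: as a corner of another triangle it would have the two other
  -- corners of that triangle and x as three distinct neighbours.
  foreign-outside : ∀ i j {w} → Edge H (corner i j) w → Foreign i w → deg H w ≤ 2 →
                    ∀ i' k → corner i' k ≢ w
  foreign-outside i j {w} e foreign w-small i' k eq with i' ≟ i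
  ... | yes refl = foreign (k , sym eq)
  ... | no i'≢i = ℕP.<⇒≱ (length≤deg three-unique three-edges) w-small
    where
    a≢x : ∀ a → corner i' a ≢ corner i j
    a≢x a eq' = i'≢i (proj₁ (corner-injective i' a i j eq'))
    three-unique : Unique (otherCorners i' k ++ corner i j ∷ [])
    three-unique with otherCorners-unique i' k
    ... | (a≢b ∷ []) ∷ _ = (a≢b ∷ a≢x (punchIn k zero) ∷ []) ∷ (a≢x (punchIn k (suc zero)) ∷ []) ∷ [] ∷ []
    three-edges : All (Edge H w) (otherCorners i' k ++ corner i j ∷ [])
    three-edges with otherCorners-edges i' k
    ... | ea ∷ eb ∷ [] = from-w ea ∷ from-w eb ∷ Edge-sym e ∷ []
      where
      from-w : ∀ {a} → Edge H (corner i' k) a → Edge H w a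
      from-w = subst (λ v → Edge H v _) eq

  exitOf : ∀ i j → 3 ≤ deg H (corner i j) → Exit i
  exitOf i j x-big with foreignNeighbour i j x-big
  ... | w , e , foreign = record
    { exitCorner   = j
    ; exit         = w
    ; toExit       = e
    ; exit-deg≤2   = w-small
    ; exit-outside = foreign-outside i j e foreign w-small
    }
    where
    w-small : deg H w ≤ 2
    w-small = ore-neighbour≤2 ore e x-big

  -- Every triangle of the family is good or has an exit (corners have degree ≥ 2).
  classify : ∀ i → AllDeg2 i ⊎ Exit i
  classify i with all? (λ j → deg H (corner i j) ℕ.≟ 2)
  ... | yes deg2 = inj₁ deg2
  ... | no not-all with ¬∀⟶∃¬ 3 _ (λ j → deg H (corner i j) ℕ.≟ 2) not-all
  ...   | j , deg≢2 = inj₂ (exitOf i j (ℕP.≤∧≢⇒< (corner-deg≥2 i j) (λ eq → deg≢2 (sym eq))))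

  -- Tokens: six for each vertex, plus the vertices of V_Δ themselves.
  Token : Set
  Token = Fin (n ℕ.* 6) ⊎ Fin n

  -- What one triangle claims: six tokens of each corner, and three further tokens.
  Claim : Set
  Claim = (Fin 3 × Fin 6) ⊎ Fin 3

  -- The three further tokens are the corners themselves (good triangle) or three of
  -- the six tokens of the exit, the block being fixed by the label of the exit
  -- corner among the at most two neighbours of the exit.
  exitLabel : ∀ {i} → Exit i → Fin 2
  exitLabel E = label (exit-deg≤2 E) (Edge-sym (toExit E))

  token : ∀ i → AllDeg2 i ⊎ Exit i → Claim → Token
  token i _        (inj₁ (j , c)) = inj₁ (combine (corner i j) c)
  token i (inj₁ _) (inj₂ j)       = inj₂ (corner i j)
  token i (inj₂ E) (inj₂ j)       = inj₁ (combine (exit E) (combine (exitLabel E) j))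

  -- Corner tokens and V_Δ-tokens are
  -- distinct since corners are; an exit is no corner; and two triangles with the
  -- same exit and the same label have the same exit corner, hence coincide.
  token-injective : ∀ i i' s s' c c' → token i s c ≡ token i' s' c' → i ≡ i' × c ≡ c'
  token-injective i i' _ _ (inj₁ (j , c)) (inj₁ (j' , c')) eq
    with combine-injective _ c _ c' (inj₁-injective eq)
  ... | corners≡ , refl with corner-injective i j i' j' corners≡
  ...   | refl , refl = refl , refl
  token-injective i i' _ (inj₂ E') (inj₁ (j , c)) (inj₂ j') eq =
    ⊥-elim (exit-outside E' i j (combine-injectiveˡ _ c _ _ (inj₁-injective eq)))
  token-injective i i' (inj₂ E) _ (inj₂ j) (inj₁ (j' , c')) eq =
    ⊥-elim (exit-outside E i' j' (sym (combine-injectiveˡ _ _ _ c' (inj₁-injective eq))))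
  token-injective i i' (inj₁ _) (inj₁ _) (inj₂ j) (inj₂ j') eq
    with corner-injective i j i' j' (inj₂-injective eq)
  ... | refl , refl = refl , refl
  token-injective i i' (inj₂ E) (inj₂ E') (inj₂ j) (inj₂ j') eq
    with combine-injective _ _ _ _ (inj₁-injective eq)
  ... | exits≡ , blocks≡ with combine-injective (exitLabel E) j (exitLabel E') j' blocks≡
  ...   | labels≡ , refl
    with corner-injective i (exitCorner E) i' (exitCorner E')
           (label-injective (exit-deg≤2 E) (exit-deg≤2 E') (Edge-sym (toExit E)) (Edge-sym (toExit E'))
                            exits≡ labels≡)
  ...     | refl , _ = refl , refl

  claim : Fin t × Claim → Token
  claim (i , c) = token i (classify i) c

  claim-injective : ∀ {x y} → claim x ≡ claim y → x ≡ y
  claim-injective {i , c} {i' , c'} eq with token-injective i i' _ _ c c' eq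
  ... | refl , refl = refl

  VΔ : List (Fin n)
  VΔ = filter (λ v → T? (inVΔ H v)) (allFin n)

  tokens : List Token
  tokens = map inj₁ (allFin (n ℕ.* 6)) ++ map inj₂ VΔ

  length-tokens : length tokens ≡ n ℕ.* 6 ℕ.+ sizeVΔ H
  length-tokens = begin
    length tokens
      ≡⟨ length-++ (map inj₁ (allFin (n ℕ.* 6))) ⟩
    length (map inj₁ (allFin (n ℕ.* 6))) ℕ.+ length (map inj₂ VΔ)
      ≡⟨ cong₂ ℕ._+_ (trans (length-map inj₁ (allFin (n ℕ.* 6))) (length-tabulate _)) (length-map inj₂ VΔ) ⟩
    n ℕ.* 6 ℕ.+ length VΔ
      ≡⟨ cong (n ℕ.* 6 ℕ.+_) (indicatorSum≡length (inVΔ H) (allFin n)) ⟨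
    n ℕ.* 6 ℕ.+ sizeVΔ H
      ∎
    where open ≡-Reasoning

  token-∈ : ∀ i s c → token i s c ∈ tokens
  token-∈ i s (inj₁ _) = ∈-++⁺ˡ (∈-map⁺ inj₁ (∈-allFin _))
  token-∈ i (inj₂ _) (inj₂ _) = ∈-++⁺ˡ (∈-map⁺ inj₁ (∈-allFin _))
  token-∈ i (inj₁ deg2) (inj₂ j) = ∈-++⁺ʳ (map inj₁ (allFin (n ℕ.* 6)))
    (∈-map⁺ inj₂ (∈-filter⁺ (λ v → T? (inVΔ H v)) (∈-allFin (corner i j)) (allDeg2⇒inVΔ deg2 j)))

  claims↔ : Fin (t ℕ.* 21) ↔ (Fin t × Claim)
  claims↔ = ↔-trans *↔× (↔-refl ×-↔ ↔-trans (+↔⊎ {18} {3}) (*↔× {3} {6} ⊎-↔ ↔-refl))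

  tokenCount : t ℕ.* 21 ≤ n ℕ.* 6 ℕ.+ sizeVΔ H
  tokenCount = subst (_ ≤_) length-tokens
    (injection⇒≤length (injection (↔⇒↣ claims↔) (mk↣ claim-injective))
                       (λ k → token-∈ _ (classify _) _))

module Arithmetic where

  import Data.Nat as ℕ
  open import Data.Integer as ℤ using (+_)
  import Data.Integer.Properties as ℤP
  open import Data.Rational using (ℚ; 1ℚ; _≤_; _*_; _-_; _/_; _+_; -_; toℚᵘ)
  open import Data.Rational.Properties
    using (normalize-coprime; toℚᵘ-injective; toℚᵘ-homo-+; toℚᵘ-homo-*; toℚᵘ-cancel-≤;
           *-assoc; *-comm; +-monoˡ-≤; *-monoˡ-≤-nonNeg; module ≤-Reasoning)
  import Data.Rational.Unnormalised as ℚᵘ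
  import Data.Rational.Unnormalised.Properties as ℚᵘP
  import Data.Nat.Coprimality as Coprime
  open import Data.Rational.Solver using (module +-*-Solver)
  open import Relation.Binary.PropositionalEquality

  ι : ℕ → ℚ
  ι a = + a / 1

  toℚᵘ-ι : ∀ a → toℚᵘ (ι a) ≡ ℚᵘ.mkℚᵘ (+ a) 0
  toℚᵘ-ι a rewrite normalize-coprime (Coprime.sym (Coprime.1-coprimeTo a)) = refl

  ι-homo : ∀ (∙ : ℚ → ℚ → ℚ) (∙ᵘ : ℚᵘ.ℚᵘ → ℚᵘ.ℚᵘ → ℚᵘ.ℚᵘ) (c a b : ℕ) →
           (∀ p q → toℚᵘ (∙ p q) ℚᵘ.≃ ∙ᵘ (toℚᵘ p) (toℚᵘ q)) →
           ℚᵘ.mkℚᵘ (+ c) 0 ℚᵘ.≃ ∙ᵘ (ℚᵘ.mkℚᵘ (+ a) 0) (ℚᵘ.mkℚᵘ (+ b) 0) →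
           ι c ≡ ∙ (ι a) (ι b)
  ι-homo ∙ ∙ᵘ c a b homo over1 = toℚᵘ-injective (begin
    toℚᵘ (ι c)                     ≡⟨ toℚᵘ-ι c ⟩
    ℚᵘ.mkℚᵘ (+ c) 0                ≈⟨ over1 ⟩
    ∙ᵘ (ℚᵘ.mkℚᵘ (+ a) 0) (ℚᵘ.mkℚᵘ (+ b) 0) ≡⟨ cong₂ ∙ᵘ (toℚᵘ-ι a) (toℚᵘ-ι b) ⟨
    ∙ᵘ (toℚᵘ (ι a)) (toℚᵘ (ι b))   ≈⟨ ℚᵘP.≃-sym (homo (ι a) (ι b)) ⟩
    toℚᵘ _                         ∎)
    where open ℚᵘP.≃-Reasoning

  ι-+ : ∀ a b → ι (a ℕ.+ b) ≡ ι a + ι b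
  ι-+ a b = ι-homo _+_ ℚᵘ._+_ (a ℕ.+ b) a b toℚᵘ-homo-+ (ℚᵘ.*≡* (begin
    + (a ℕ.+ b) ℤ.* + 1                ≡⟨ ℤP.*-identityʳ _ ⟩
    + (a ℕ.+ b)                        ≡⟨ ℤP.pos-+ a b ⟩
    + a ℤ.+ + b                        ≡⟨ cong₂ ℤ._+_ (ℤP.*-identityʳ (+ a)) (ℤP.*-identityʳ (+ b)) ⟨
    + a ℤ.* + 1 ℤ.+ + b ℤ.* + 1        ≡⟨ ℤP.*-identityʳ _ ⟨
    (+ a ℤ.* + 1 ℤ.+ + b ℤ.* + 1) ℤ.* + 1 ∎))
    where open ≡-Reasoning

  ι-* : ∀ a b → ι (a ℕ.* b) ≡ ι a * ι b
  ι-* a b = ι-homo _*_ ℚᵘ._*_ (a ℕ.* b) a b toℚᵘ-homo-* (ℚᵘ.*≡* (begin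
    + (a ℕ.* b) ℤ.* + 1      ≡⟨ ℤP.*-identityʳ _ ⟩
    + (a ℕ.* b)              ≡⟨ ℤP.pos-* a b ⟩
    + a ℤ.* + b              ≡⟨ ℤP.*-identityʳ _ ⟨
    (+ a ℤ.* + b) ℤ.* + 1    ∎))
    where open ≡-Reasoning

  ι-mono : ∀ {a b} → a ℕ.≤ b → ι a ≤ ι b
  ι-mono {a} {b} a≤b = toℚᵘ-cancel-≤
    (subst₂ ℚᵘ._≤_ (sym (toℚᵘ-ι a)) (sym (toℚᵘ-ι b))
      (ℚᵘ.*≤* (subst₂ ℤ._≤_ (sym (ℤP.*-identityʳ (+ a))) (sym (ℤP.*-identityʳ (+ b))) (ℤ.+≤+ a≤b))))

  linearBound : (ν : ℚ) (n t s : ℕ) → (1ℚ - ν) * ι n ≤ ι 3 * ι t → t ℕ.* 21 ℕ.≤ n ℕ.* 6 ℕ.+ s →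
                ι n * (1ℚ - ι 7 * ν) ≤ ι s
  linearBound ν n t s packing count = begin
    ι n * (1ℚ - ι 7 * ν)                       ≡⟨ cong (λ c → ι n * (1ℚ - c * ν)) (ι-+ 6 1) ⟩
    ι n * (1ℚ - (ι 6 + 1ℚ) * ν)                ≡⟨ expand (ι n) ν (ι 6) ⟩
    (ι 6 + 1ℚ) * ((1ℚ - ν) * ι n) - ι 6 * ι n  ≤⟨ +-monoˡ-≤ (- (ι 6 * ι n)) (*-monoˡ-≤-nonNeg (ι 7) packing) ⟩
    ι 7 * (ι 3 * ι t) - ι 6 * ι n              ≡⟨ cong₂ _-_ 21t (trans (*-comm (ι 6) (ι n)) (sym (ι-* n 6))) ⟩
    ι (t ℕ.* 21) - ι (n ℕ.* 6)                 ≤⟨ +-monoˡ-≤ (- ι (n ℕ.* 6)) (ι-mono count) ⟩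
    ι (n ℕ.* 6 ℕ.+ s) - ι (n ℕ.* 6)            ≡⟨ cong (_- ι (n ℕ.* 6)) (ι-+ (n ℕ.* 6) s) ⟩
    ι (n ℕ.* 6) + ι s - ι (n ℕ.* 6)            ≡⟨ cancel (ι (n ℕ.* 6)) (ι s) ⟩
    ι s                                        ∎
    where
    open ≤-Reasoning
    open +-*-Solver
    expand : ∀ N v B → N * (1ℚ - (B + 1ℚ) * v) ≡ (B + 1ℚ) * ((1ℚ - v) * N) - B * N
    expand = solve 3 (λ N v B → N :* (con 1ℚ :- (B :+ con 1ℚ) :* v)
                               := (B :+ con 1ℚ) :* ((con 1ℚ :- v) :* N) :- B :* N) refl
    cancel : ∀ X S → X + S - X ≡ S
    cancel = solve 2 (λ X S → X :+ S :- X := S) refl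
    21t : ι 7 * (ι 3 * ι t) ≡ ι (t ℕ.* 21)
    21t = trans (sym (*-assoc (ι 7) (ι 3) (ι t))) (trans (*-comm (ι 21) (ι t)) (sym (ι-* t 21)))

open import Data.Integer using (+_)
open import Data.Rational using (ℚ; 0ℚ; 1ℚ; _<_; _≤_; _*_; _-_; _/_)
open import Data.Product using (_,_)

lemma16 : (ν : ℚ) → 0ℚ < ν → ν < 1ℚ →
          (n : ℕ) (H : Graph n) →
          OreDegreeAtMost H 5 →
          TriangularExtreme H ν →
          (+ n / 1) * (1ℚ - (+ 7 / 1) * ν) ≤ (+ sizeVΔ H / 1)
lemma16 ν _ _ n H ore (t , (triangles , disjoint) , packing) =
  Arithmetic.linearBound ν n t (sizeVΔ H) packing
    (TriangleFamily.tokenCount H ore triangles disjoint)
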